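{- For integers $m \geq 3$ and $n \geq 3$ with $m+n$ odd, the graph $C(m,n)$ is not super edge-magic.
   Context: All graphs are finite, without loops or multiple edges. For integers $m \geq 3$ and $n \geq 3$, $C(m,n)$ denotes the graph consisting of a cycle of order $m$ and a cycle of order $n$ that share exactly one vertex (and no other vertices or edges). A graph $G$ is super edge-magic if there exists a bijective function $f:V(G) \cup E(G)\rightarrow \{1, 2, \ldots , |V(G)| + |E(G)|\}$ such that $f(V(G)) =\{1, 2, \ldots , |V(G)|\}$ and $f(u) + f(v) + f(uv)$ is the same constant for every edge $uv\in E(G)$. -}

module Defs where

open import Data.Nat using (ℕ; zero; suc; _+_; _∸_; _<_; _≡ᵇ_; _<ᵇ_)
open import Data.Nat.DivMod using (_mod_)
open import Data.Fin using (Fin; toℕ)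
open import Data.Sum using (_⊎_; inj₁; inj₂)
open import Data.Product using (_×_; _,_; Σ; ∃; proj₁; proj₂)
open import Data.Bool using (if_then_else_)
open import Function.Definitions using (Bijective)
open import Relation.Binary.PropositionalEquality using (_≡_)

record Graph : Set where
  field
    nV   : ℕ
    nE   : ℕ
    ends : Fin nE → Fin nV × Fin nV
open Graph public

-- Super edge-magic: a bijection f : V ⊎ E → {1,…,|V|+|E|} (labels encoded as
-- Fin (|V|+|E|), label = 1 + toℕ), with f(V) = {1,…,|V|}, and a constant k with
-- f(u) + f(v) + f(uv) = k for every edge uv.
SuperEdgeMagic : Graph → Set
SuperEdgeMagic G =
  Σ (Fin (nV G) ⊎ Fin (nE G) → Fin (nV G + nE G)) λ f →
    Bijective _≡_ _≡_ f
    × (∀ v → toℕ (f (inj₁ v)) < nV G)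
    × ∃ λ k → ∀ e →
        let lab = λ x → suc (toℕ (f x)) in
        lab (inj₁ (proj₁ (ends G e))) + lab (inj₁ (proj₂ (ends G e))) + lab (inj₂ e) ≡ k

-- C(m,n): vertices 0,…,m+n-2 (order m+n-1; written suc (m+n∸2), equal for m+n ≥ 2).
-- Cycle 1: 0,1,…,m-1,0.  Cycle 2: 0,m,m+1,…,m+n-2,0.  Shared vertex: 0.
-- Edges 0..m-1 belong to cycle 1, edges m..m+n-1 to cycle 2.
module _ (m n : ℕ) where
  private
    p : ℕ
    p = suc (m + n ∸ 2)

    vx : ℕ → Fin p
    vx k = k mod p

    nxt1 : ℕ → ℕ
    nxt1 i = if suc i ≡ᵇ m then 0 else suc i

    w : ℕ → ℕ
    w j = if j ≡ᵇ 0 then 0 else m + j ∸ 1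

    nxt2 : ℕ → ℕ
    nxt2 j = if suc j ≡ᵇ n then 0 else suc j

    ends' : Fin (m + n) → Fin p × Fin p
    ends' e =
      let i = toℕ e in
      if i <ᵇ m
        then (vx i , vx (nxt1 i))
        else (vx (w (i ∸ m)) , vx (w (nxt2 (i ∸ m))))

  C : Graph
  C = record { nV = p ; nE = m + n ; ends = ends' }

-- Summing the magic equation f(u) + f(v) + f(uv) = k over the m + n edges gives
-- (m + n) k = ∑ deg(v) f(v) + ∑ (edge labels).  In C(m,n) every vertex has degree 2
-- except the shared one, of degree 4, and the labels are 1,…,p on the p = m + n − 1
-- vertices and p+1,…,p+q on the q = m + n edges.  When q = 2r + 1 is odd, everything
-- except the extra 2 f(shared) is a multiple of q, so q divides 2 f(shared); but
-- 0 < f(shared) < q and q is odd.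
module Submission where

open import Defs
open import Data.Nat using (ℕ; zero; suc; _+_; _*_; _∸_; _≤_; _<_; _%_; _/_; _≡ᵇ_; _<ᵇ_; s≤s; z≤n)
open import Data.Nat.Properties
open import Data.Nat.DivMod using (_mod_; m<n⇒m%n≡m; m≡m%n+[m/n]*n)
open import Data.Nat.Divisibility using (_∣_; divides; ∣m+n∣m⇒∣n; m∣m*n)
open import Data.Nat.Tactic.RingSolver using (solve-∀)
open import Data.Fin as Fin using (Fin; toℕ; fromℕ<; punchOut)
open import Data.Fin.Properties using (toℕ-injective; toℕ-fromℕ<; toℕ<n; nonZeroIndex; any?; punchOut-injective; injective⇒≤)
  renaming (_≟_ to _≟ᶠ_)
open import Data.Fin.Permutation using (Permutation; permutation)
open import Data.Sum using (_⊎_; inj₁; inj₂)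
open import Data.Sum.Properties using (inj₁-injective; inj₂-injective)
open import Data.Product using (_×_; _,_; proj₁; proj₂; ∃)
open import Data.Bool using (true; false; T; if_then_else_)
open import Data.Unit using (tt)
open import Data.Empty using (⊥; ⊥-elim)
open import Function using (_∘_)
open import Function.Definitions using (Injective)
open import Relation.Nullary using (¬_; yes; no)
open import Relation.Binary.PropositionalEquality
open import Algebra.Properties.CommutativeMonoid.Sum +-0-commutativeMonoid
  using (sum; sum-syntax; sum-cong-≗; ∑-distrib-+; sum-permute)

open ≡-Reasoning

∑-const : ∀ n c → ∑[ i < n ] c ≡ n * c
∑-const zero    c = refl
∑-const (suc n) c = cong (c +_) (∑-const n c)

∑-cong< : ∀ n {g h : ℕ → ℕ} → (∀ i → i < n → g i ≡ h i) →
          ∑[ i < n ] g (toℕ i) ≡ ∑[ i < n ] h (toℕ i)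
∑-cong< n g≡h = sum-cong-≗ (λ i → g≡h (toℕ i) (toℕ<n i))

∑-snoc : ∀ n (h : ℕ → ℕ) → ∑[ i < suc n ] h (toℕ i) ≡ ∑[ i < n ] h (toℕ i) + h n
∑-snoc zero    h = +-comm (h 0) 0
∑-snoc (suc n) h = trans (cong (h 0 +_) (∑-snoc n (λ i → h (suc i)))) (sym (+-assoc (h 0) _ _))

∑-split : ∀ a b (h : ℕ → ℕ) →
          ∑[ i < a + b ] h (toℕ i) ≡ ∑[ i < a ] h (toℕ i) + ∑[ j < b ] h (a + toℕ j)
∑-split zero    b h = refl
∑-split (suc a) b h = trans (cong (h 0 +_) (∑-split a b (λ i → h (suc i)))) (sym (+-assoc (h 0) _ _))

next : ℕ → ℕ → ℕ
next k i = if suc i ≡ᵇ k then 0 else suc i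

if-T : ∀ {A : Set} {b} {x y : A} → T b → (if b then x else y) ≡ x
if-T {b = true} _ = refl

if-¬T : ∀ {A : Set} {b} {x y : A} → ¬ T b → (if b then x else y) ≡ y
if-¬T {b = false} _  = refl
if-¬T {b = true}  ¬t = ⊥-elim (¬t tt)

∑-rotate : ∀ M (h : ℕ → ℕ) → ∑[ i < suc M ] h (next (suc M) (toℕ i)) ≡ ∑[ i < suc M ] h (toℕ i)
∑-rotate M h = begin
    ∑[ i < suc M ] h (next (suc M) (toℕ i))
  ≡⟨ ∑-snoc M (λ i → h (next (suc M) i)) ⟩
    ∑[ i < M ] h (next (suc M) (toℕ i)) + h (next (suc M) M)
  ≡⟨ cong₂ _+_ (∑-cong< M {g = λ i → h (next (suc M) i)} {h = λ i → h (suc i)}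
                        (λ i i<M → cong h (if-¬T (<⇒≢ i<M ∘ ≡ᵇ⇒≡ i M))))
               (cong h (if-T (≡⇒≡ᵇ M M refl))) ⟩
    ∑[ i < M ] h (suc (toℕ i)) + h 0
  ≡⟨ +-comm _ (h 0) ⟩
    ∑[ i < suc M ] h (toℕ i) ∎

∑-cycle : ∀ M (h : ℕ → ℕ) →
          ∑[ i < suc M ] (h (toℕ i) + h (next (suc M) (toℕ i))) ≡ 2 * ∑[ i < suc M ] h (toℕ i)
∑-cycle M h = begin
    ∑[ i < suc M ] (h (toℕ i) + h (next (suc M) (toℕ i)))
  ≡⟨ ∑-distrib-+ {suc M} (λ i → h (toℕ i)) (λ i → h (next (suc M) (toℕ i))) ⟩
    s + ∑[ i < suc M ] h (next (suc M) (toℕ i))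
  ≡⟨ cong (s +_) (∑-rotate M h) ⟩
    s + s
  ≡⟨ cong (s +_) (sym (+-identityʳ s)) ⟩
    2 * s ∎
  where
  s : ℕ
  s = ∑[ i < suc M ] h (toℕ i)

triangle : ℕ → ℕ
triangle n = ∑[ i < n ] toℕ i

triangle-suc : ∀ n → triangle (suc n) ≡ n + triangle n
triangle-suc n = begin
    ∑[ i < n ] (1 + toℕ i)
  ≡⟨ ∑-distrib-+ {n} (λ _ → 1) toℕ ⟩
    ∑[ i < n ] 1 + triangle n
  ≡⟨ cong (_+ triangle n) (trans (∑-const n 1) (*-identityʳ n)) ⟩
    n + triangle n ∎

2*triangle : ∀ n → 2 * triangle (suc n) ≡ n * suc n
2*triangle zero    = refl
2*triangle (suc n) = begin
    2 * triangle (suc (suc n))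
  ≡⟨ cong (2 *_) (triangle-suc (suc n)) ⟩
    2 * (suc n + triangle (suc n))
  ≡⟨ *-distribˡ-+ 2 (suc n) (triangle (suc n)) ⟩
    2 * suc n + 2 * triangle (suc n)
  ≡⟨ cong (2 * suc n +_) (2*triangle n) ⟩
    2 * suc n + n * suc n
  ≡⟨ *-distribʳ-+ (suc n) 2 n ⟨
    suc (suc n) * suc n
  ≡⟨ *-comm (suc (suc n)) (suc n) ⟩
    suc n * suc (suc n) ∎

injective⇒surjective : ∀ {n} {g : Fin n → Fin n} → Injective _≡_ _≡_ g → ∀ y → ∃ λ x → g x ≡ y
injective⇒surjective {suc n} {g} g-inj y with any? (λ x → g x ≟ᶠ y)
... | yes hit = hit
... | no miss = ⊥-elim (1+n≰n (injective⇒≤ avoid-y-injective))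
  where
  g≢y : ∀ x → y ≢ g x
  g≢y x y≡gx = miss (x , sym y≡gx)
  avoid-y-injective : Injective _≡_ _≡_ (λ x → punchOut (g≢y x))
  avoid-y-injective {a} {b} eq = g-inj (punchOut-injective (g≢y a) (g≢y b) eq)

∑-reindex-injective : ∀ {n} {g : Fin n → Fin n} → Injective _≡_ _≡_ g →
                      ∀ (h : Fin n → ℕ) → ∑[ i < n ] h (g i) ≡ ∑[ i < n ] h i
∑-reindex-injective {n} {g} g-inj h = sym (sum-permute {n} {n} h π)
  where
  π : Permutation n n
  π = permutation g (λ y → proj₁ (injective⇒surjective g-inj y))
                    (λ y → proj₂ (injective⇒surjective g-inj y))
                    (λ x → g-inj (proj₂ (injective⇒surjective g-inj (g x))))

label : ∀ {X : Set} {n} → (X → Fin n) → X → ℕ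
label f x = suc (toℕ (f x))

module Labelling {V E : ℕ} (f : Fin V ⊎ Fin E → Fin (V + E)) (f-inj : Injective _≡_ _≡_ f)
                 (vertex< : ∀ v → toℕ (f (inj₁ v)) < V) where

  toℕ-f-injective : ∀ {x y} → toℕ (f x) ≡ toℕ (f y) → x ≡ y
  toℕ-f-injective = f-inj ∘ toℕ-injective

  vertexLabel : Fin V → Fin V
  vertexLabel v = fromℕ< (vertex< v)

  vertexLabel-injective : Injective _≡_ _≡_ vertexLabel
  vertexLabel-injective {a} {b} eq = inj₁-injective (toℕ-f-injective (begin
      toℕ (f (inj₁ a))    ≡⟨ toℕ-fromℕ< (vertex< a) ⟨
      toℕ (vertexLabel a) ≡⟨ cong toℕ eq ⟩
      toℕ (vertexLabel b) ≡⟨ toℕ-fromℕ< (vertex< b) ⟩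
      toℕ (f (inj₁ b))    ∎))

  -- The vertices already use up every label below V.
  V≤edge : ∀ e → V ≤ toℕ (f (inj₂ e))
  V≤edge e = ≮⇒≥ λ e<V → vertex≢edge e<V (injective⇒surjective vertexLabel-injective (fromℕ< e<V))
    where
    vertex≢edge : ∀ e<V → ∃ (λ v → vertexLabel v ≡ fromℕ< e<V) → ⊥
    vertex≢edge e<V (v , eq) with toℕ-f-injective (begin
        toℕ (f (inj₁ v))      ≡⟨ toℕ-fromℕ< (vertex< v) ⟨
        toℕ (vertexLabel v)   ≡⟨ cong toℕ eq ⟩
        toℕ (fromℕ< e<V)      ≡⟨ toℕ-fromℕ< e<V ⟩
        toℕ (f (inj₂ e))      ∎)
    ... | ()

  edgeLabel< : ∀ e → toℕ (f (inj₂ e)) ∸ V < E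
  edgeLabel< e = m<n+o⇒m∸n<o (toℕ (f (inj₂ e))) V {{nonZeroIndex e}} (toℕ<n (f (inj₂ e)))

  edgeLabel : Fin E → Fin E
  edgeLabel e = fromℕ< (edgeLabel< e)

  V+edgeLabel : ∀ e → V + toℕ (edgeLabel e) ≡ toℕ (f (inj₂ e))
  V+edgeLabel e = trans (cong (V +_) (toℕ-fromℕ< (edgeLabel< e))) (m+[n∸m]≡n (V≤edge e))

  edgeLabel-injective : Injective _≡_ _≡_ edgeLabel
  edgeLabel-injective {a} {b} eq = inj₂-injective (toℕ-f-injective (begin
      toℕ (f (inj₂ a))        ≡⟨ V+edgeLabel a ⟨
      V + toℕ (edgeLabel a)   ≡⟨ cong (λ x → V + toℕ x) eq ⟩
      V + toℕ (edgeLabel b)   ≡⟨ V+edgeLabel b ⟩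
      toℕ (f (inj₂ b))        ∎))

  vertexLabel-sum : ∑[ v < V ] label f (inj₁ v) ≡ triangle (suc V)
  vertexLabel-sum = begin
      ∑[ v < V ] suc (toℕ (f (inj₁ v)))
    ≡⟨ sum-cong-≗ {V} (λ v → cong suc (toℕ-fromℕ< (vertex< v))) ⟨
      ∑[ v < V ] suc (toℕ (vertexLabel v))
    ≡⟨ ∑-reindex-injective vertexLabel-injective (λ i → suc (toℕ i)) ⟩
      ∑[ i < V ] suc (toℕ i) ∎

  edgeLabel-sum : ∑[ e < E ] label f (inj₂ e) ≡ E * V + triangle (suc E)
  edgeLabel-sum = begin
      ∑[ e < E ] suc (toℕ (f (inj₂ e)))
    ≡⟨ sum-cong-≗ {E} (λ e → trans (+-suc V _) (cong suc (V+edgeLabel e))) ⟨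
      ∑[ e < E ] (V + suc (toℕ (edgeLabel e)))
    ≡⟨ ∑-distrib-+ {E} (λ _ → V) (λ e → suc (toℕ (edgeLabel e))) ⟩
      ∑[ e < E ] V + ∑[ e < E ] suc (toℕ (edgeLabel e))
    ≡⟨ cong₂ _+_ (∑-const E V) (∑-reindex-injective edgeLabel-injective (λ i → suc (toℕ i))) ⟩
      E * V + triangle (suc E) ∎

weight : ∀ {V} → (Fin V → ℕ) → Fin V × Fin V → ℕ
weight ℓ (u , v) = ℓ u + ℓ v

endpointSum : (G : Graph) → (Fin (nV G) → ℕ) → ℕ
endpointSum G ℓ = ∑[ e < nE G ] weight ℓ (ends G e)

magic-sum : ∀ (G : Graph) (f : Fin (nV G) ⊎ Fin (nE G) → Fin (nV G + nE G)) →
            Injective _≡_ _≡_ f → (∀ v → toℕ (f (inj₁ v)) < nV G) →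
            ∀ k → (∀ e → let ℓ = label f in
                         ℓ (inj₁ (proj₁ (ends G e))) + ℓ (inj₁ (proj₂ (ends G e))) + ℓ (inj₂ e) ≡ k) →
            nE G * k ≡ endpointSum G (label f ∘ inj₁) + (nE G * nV G + triangle (suc (nE G)))
magic-sum G f f-inj vertex< k magic = begin
    nE G * k
  ≡⟨ ∑-const (nE G) k ⟨
    ∑[ e < nE G ] k
  ≡⟨ sum-cong-≗ {nE G} magic ⟨
    ∑[ e < nE G ] (weight ℓ (ends G e) + label f (inj₂ e))
  ≡⟨ ∑-distrib-+ {nE G} (weight ℓ ∘ ends G) (label f ∘ inj₂) ⟩
    endpointSum G ℓ + ∑[ e < nE G ] label f (inj₂ e)
  ≡⟨ cong (endpointSum G ℓ +_) (Labelling.edgeLabel-sum f f-inj vertex<) ⟩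
    endpointSum G ℓ + (nE G * nV G + triangle (suc (nE G))) ∎
  where
  ℓ : Fin (nV G) → ℕ
  ℓ = label f ∘ inj₁

module CycleGraph (M N : ℕ) where

  private
    m n p : ℕ
    m = suc M
    n = suc N
    p = nV (C m n)

  order : p ≡ m + N
  order = cong suc (cong (_∸ 1) (+-suc M N))

  vertex : ℕ → Fin p
  vertex k = k mod p

  w : ℕ → ℕ
  w j = if j ≡ᵇ 0 then 0 else m + j ∸ 1

  edge : ℕ → Fin p × Fin p
  edge i = if i <ᵇ m then (vertex i , vertex (next m i))
                      else (vertex (w (i ∸ m)) , vertex (w (next n (i ∸ m))))

  edge-first : ∀ {i} → i < m → edge i ≡ (vertex i , vertex (next m i))
  edge-first i<m = if-T (<⇒<ᵇ i<m)

  edge-second : ∀ j → edge (m + j) ≡ (vertex (w j) , vertex (w (next n j)))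
  edge-second j = begin
      edge (m + j)
    ≡⟨ if-¬T (m+n≮m m j ∘ <ᵇ⇒< (m + j) m) ⟩
      (vertex (w (m + j ∸ m)) , vertex (w (next n (m + j ∸ m))))
    ≡⟨ cong (λ i → (vertex (w i) , vertex (w (next n i)))) (m+n∸m≡n m j) ⟩
      (vertex (w j) , vertex (w (next n j))) ∎

  vertex-toℕ : ∀ v → vertex (toℕ v) ≡ v
  vertex-toℕ v = toℕ-injective (trans (toℕ-fromℕ< _) (m<n⇒m%n≡m (toℕ<n v)))

  second-cycle-sum : ∀ (A : ℕ → ℕ) → ∑[ j < n ] A (w (toℕ j)) ≡ A 0 + ∑[ j < N ] A (m + toℕ j)
  second-cycle-sum A = cong (A 0 +_) (sum-cong-≗ {N} (λ j → cong A (+-suc M (toℕ j))))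

  endpointSum-C : ∀ ℓ → endpointSum (C m n) ℓ ≡ 2 * ∑[ v < p ] ℓ v + 2 * ℓ Fin.zero
  endpointSum-C ℓ = begin
      ∑[ e < m + n ] weight ℓ (edge (toℕ e))
    ≡⟨ ∑-split m n (weight ℓ ∘ edge) ⟩
      ∑[ i < m ] weight ℓ (edge (toℕ i)) + ∑[ j < n ] weight ℓ (edge (m + toℕ j))
    ≡⟨ cong₂ _+_ (∑-cong< m (λ i i<m → cong (weight ℓ) (edge-first i<m)))
                 (sum-cong-≗ {n} (λ j → cong (weight ℓ) (edge-second (toℕ j)))) ⟩
      ∑[ i < m ] (A (toℕ i) + A (next m (toℕ i))) + ∑[ j < n ] (A (w (toℕ j)) + A (w (next n (toℕ j))))
    ≡⟨ cong₂ _+_ (∑-cycle M A) (∑-cycle N (A ∘ w)) ⟩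
      2 * ∑[ i < m ] A (toℕ i) + 2 * ∑[ j < n ] A (w (toℕ j))
    ≡⟨ cong (λ s → 2 * ∑[ i < m ] A (toℕ i) + 2 * s) (second-cycle-sum A) ⟩
      2 * ∑[ i < m ] A (toℕ i) + 2 * (A 0 + ∑[ j < N ] A (m + toℕ j))
    ≡⟨ regroup (∑[ i < m ] A (toℕ i)) (A 0) (∑[ j < N ] A (m + toℕ j)) ⟩
      2 * (∑[ i < m ] A (toℕ i) + ∑[ j < N ] A (m + toℕ j)) + 2 * A 0
    ≡⟨ cong (λ s → 2 * s + 2 * A 0) (∑-split m N A) ⟨
      2 * ∑[ i < m + N ] A (toℕ i) + 2 * A 0
    ≡⟨ cong (λ s → 2 * s + 2 * A 0) vertex-sum ⟩
      2 * ∑[ v < p ] ℓ v + 2 * ℓ Fin.zero ∎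
    where
    A : ℕ → ℕ
    A = ℓ ∘ vertex
    regroup : ∀ a c b → 2 * a + 2 * (c + b) ≡ 2 * (a + b) + 2 * c
    regroup = solve-∀
    vertex-sum : ∑[ i < m + N ] A (toℕ i) ≡ ∑[ v < p ] ℓ v
    vertex-sum = trans (cong (λ z → ∑[ i < z ] A (toℕ i)) (sym order))
                       (sum-cong-≗ {p} (λ v → cong ℓ (vertex-toℕ v)))

odd∤double : ∀ r c → 0 < c → c < suc (2 * r) → ¬ suc (2 * r) ∣ 2 * c
odd∤double r c 0<c c<q (divides zero 2c≡0) = <⇒≢ 0<c (sym (m+n≡0⇒m≡0 c 2c≡0))
odd∤double r c 0<c c<q (divides 1 2c≡q) = even≢odd c r (trans 2c≡q (+-identityʳ _))
odd∤double r c 0<c c<q (divides (suc (suc z)) eq) =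
  <-irrefl eq (<-≤-trans (*-monoʳ-< 2 c<q) (*-monoˡ-≤ (suc (2 * r)) (m≤m+n 2 z)))

labelSum-multiple : ∀ r → let p = 2 * r; q = suc p in
             2 * triangle (suc p) + (q * p + triangle (suc q)) ≡ q * (p + p + suc r)
labelSum-multiple r = begin
    2 * triangle (suc p) + (q * p + triangle (suc q))
  ≡⟨ cong₂ (λ a b → a + (q * p + b)) (2*triangle p) half-triangle-q ⟩
    p * q + (q * p + q * suc r)
  ≡⟨ regroup p q (suc r) ⟩
    q * (p + p + suc r) ∎
  where
  p q : ℕ
  p = 2 * r
  q = suc p
  half-triangle-q : triangle (suc q) ≡ q * suc r
  half-triangle-q = *-cancelˡ-≡ _ _ 2 (trans (2*triangle q) (double-q r))
    where double-q : ∀ r → suc (2 * r) * suc (suc (2 * r)) ≡ 2 * (suc (2 * r) * suc r)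
          double-q = solve-∀
  regroup : ∀ p q s → p * q + (q * p + q * s) ≡ q * (p + p + s)
  regroup = solve-∀

no-magic-constant : ∀ {p q} r k c → p ≡ 2 * r → q ≡ suc p → 0 < c → c ≤ p →
                    q * k ≢ 2 * triangle (suc p) + 2 * c + (q * p + triangle (suc q))
no-magic-constant {p} {q} r k c refl refl 0<c c≤p magic = odd∤double r c 0<c (s≤s c≤p) q∣2c
  where
  total : ℕ
  total = p + p + suc r
  regroup : ∀ x y z → x + z + y ≡ x + y + z
  regroup = solve-∀
  q∣total+2c : q ∣ q * total + 2 * c
  q∣total+2c = divides k (begin
      q * total + 2 * c
    ≡⟨ cong (_+ 2 * c) (labelSum-multiple r) ⟨
      2 * triangle (suc p) + (q * p + triangle (suc q)) + 2 * c
    ≡⟨ regroup (2 * triangle (suc p)) (2 * c) (q * p + triangle (suc q)) ⟩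
      2 * triangle (suc p) + 2 * c + (q * p + triangle (suc q))
    ≡⟨ magic ⟨
      q * k
    ≡⟨ *-comm q k ⟩
      k * q ∎)
  q∣2c : q ∣ 2 * c
  q∣2c = ∣m+n∣m⇒∣n q∣total+2c (m∣m*n total)

corollary2p1 : (m n : ℕ) → 3 ≤ m → 3 ≤ n → (m + n) % 2 ≡ 1 → ¬ SuperEdgeMagic (C m n)
corollary2p1 m@(suc M) n@(suc N) (s≤s _) (s≤s _) odd (f , (f-inj , _) , vertex< , k , magic) =
  no-magic-constant r k c p≡2r q≡suc-p (s≤s z≤n) (vertex< Fin.zero) (begin
    (m + n) * k
  ≡⟨ magic-sum (C m n) f f-inj vertex< k magic ⟩
    endpointSum (C m n) ℓ + edgeTotal
  ≡⟨ cong (_+ edgeTotal) (endpointSum-C ℓ) ⟩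
    2 * ∑[ v < p ] ℓ v + 2 * c + edgeTotal
  ≡⟨ cong (λ s → 2 * s + 2 * c + edgeTotal) (Labelling.vertexLabel-sum f f-inj vertex<) ⟩
    2 * triangle (suc p) + 2 * c + edgeTotal ∎)
  where
  open CycleGraph M N using (order; endpointSum-C)
  p c r edgeTotal : ℕ
  p = nV (C m n)
  ℓ : Fin p → ℕ
  ℓ = label f ∘ inj₁
  c = ℓ Fin.zero
  edgeTotal = (m + n) * p + triangle (suc (m + n))
  r = (m + n) / 2
  q≡suc-p : m + n ≡ suc p
  q≡suc-p = trans (+-suc m N) (cong suc (sym order))
  p≡2r : p ≡ 2 * r
  p≡2r = suc-injective (begin
      suc p                      ≡⟨ q≡suc-p ⟨
      m + n                      ≡⟨ m≡m%n+[m/n]*n (m + n) 2 ⟩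
      (m + n) % 2 + r * 2        ≡⟨ cong₂ _+_ odd (*-comm r 2) ⟩
      suc (2 * r)                ∎)
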